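{- Let $G=(A,B,E)$ be a chordal bipartite graph. Then $G^*$ is chordal.
   Context: A chordal bipartite graph is a bipartite graph with no induced cycle of length at least $6$. $G^*$ is the graph on $V(G)$ whose edges are the pairs $uv$ with $d_G(u,v)=2$. A graph is chordal if it has no induced cycle of length at least $4$. -}

module Defs where

open import Data.Nat using (ℕ; zero; suc; _≤_)
open import Data.Fin using (Fin; toℕ)
open import Data.Bool using (Bool)
open import Data.Product using (Σ; ∃; _×_; _,_)
open import Data.Sum using (_⊎_)
open import Relation.Nullary using (¬_; Dec)
open import Relation.Binary.PropositionalEquality using (_≡_; _≢_)
open import Function.Bundles using (_⇔_)
open import Function.Definitions using (Injective)

record Graph (n : ℕ) : Set₁ where
  field
    Adj    : Fin n → Fin n → Set
    sym    : ∀ {u v} → Adj u v → Adj v u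
    irrefl : ∀ {u} → ¬ Adj u u
    adj?   : ∀ u v → Dec (Adj u v)
open Graph public

Dist2 : ∀ {n} → Graph n → Fin n → Fin n → Set
Dist2 {n} G u v = u ≢ v × ¬ Adj G u v × Σ (Fin n) (λ w → Adj G u w × Adj G w v)

CycAdj : (k : ℕ) → Fin k → Fin k → Set
CycAdj k i j =
    suc (toℕ i) ≡ toℕ j
  ⊎ suc (toℕ j) ≡ toℕ i
  ⊎ (toℕ i ≡ 0 × suc (toℕ j) ≡ k)
  ⊎ (toℕ j ≡ 0 × suc (toℕ i) ≡ k)

InducedCycleR : ∀ {n} → (Fin n → Fin n → Set) → ℕ → Set
InducedCycleR {n} R k =
  Σ (Fin k → Fin n) λ v → Injective _≡_ _≡_ v × (∀ i j → R (v i) (v j) ⇔ CycAdj k i j)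

InducedCycle : ∀ {n} → Graph n → ℕ → Set
InducedCycle G k = InducedCycleR (Adj G) k

-- Bipartite with bipartition (A,B): colour c, A = c⁻¹(true), B = c⁻¹(false),
-- every edge joins A and B.
Bipartite : ∀ {n} → Graph n → Set
Bipartite {n} G = Σ (Fin n → Bool) λ c → ∀ u v → Adj G u v → c u ≢ c v

ChordalBipartite : ∀ {n} → Graph n → Set
ChordalBipartite G = Bipartite G × (∀ k → 6 ≤ k → ¬ InducedCycle G k)

-- Chordal: no induced cycle of length ≥ 4 (stated for a relation, so it can
-- be applied to G* directly).
ChordalR : ∀ {n} → (Fin n → Fin n → Set) → Set
ChordalR R = ∀ k → 4 ≤ k → ¬ InducedCycleR R k

Star : ∀ {n} → Graph n → Fin n → Fin n → Set
Star G = Dist2 G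

-- All vertices of an induced cycle v₀ … v_{k-1} of G* lie on one side of the bipartition,
-- since vertices at distance 2 share a colour. Choosing a common neighbour bᵢ of vᵢ and vᵢ₊₁,
-- the closed walk v₀ b₀ v₁ b₁ … is an induced cycle of length 2k ≥ 8 in G: a neighbour of vᵢ
-- adjacent to v_j puts v_j at distance 2 from vᵢ, so i and j are consecutive, and for k ≥ 4
-- this leaves b_j adjacent to v_j and v_{j+1} only.
module Submission where

open import Defs renaming (sym to adj-sym)
open import Data.Nat using (ℕ; zero; suc; _+_; _*_; _∸_; _<_; _≤_; z≤n; s≤s; z<s; NonZero)
open import Data.Nat.Properties
  using (+-identityʳ; +-suc; +-comm; *-comm; m<m+n; +-monoʳ-<; ∸-monoˡ-<; m+n∸n≡m; <-irrefl; <-trans;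
         ≤-trans; ≮⇒≥; n≤1+n; *-monoˡ-≤; m≤n⇒m<n∨m≡n; m*n≢0; _<?_)
open import Data.Nat.DivMod
  using (_%_; _mod_; %-distribˡ-+; m%n%n≡m%n; m<n⇒m%n≡m; n%n≡0; m≤n⇒[n∸m]%m≡n%m; m%n*o≡m*o%[n*o])
open import Data.Nat.GeneralisedArithmetic using (iterate)
open import Data.Fin using (Fin; zero; suc; toℕ; combine; remQuot)
open import Data.Fin.Patterns using (0F; 1F)
open import Data.Fin.Properties
  using (toℕ-injective; toℕ<n; toℕ-fromℕ<; toℕ-combine; combine-remQuot; combine-surjective; remQuot-combine; _≟_)
open import Data.Bool using (Bool)
open import Data.Bool.Properties using (¬-not)
open import Data.Product using (_×_; _,_; proj₁; proj₂; uncurry)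
open import Data.Sum using (_⊎_; inj₁; inj₂; swap)
open import Data.Empty using (⊥-elim)
open import Function using (_∘_)
open import Function.Bundles using (_⇔_; mk⇔; Equivalence)
open import Function.Definitions using (Injective)
open import Function.Properties.Equivalence using () renaming (trans to ⇔-trans; sym to ⇔-sym)
open import Relation.Nullary using (¬_; yes; no)
open import Relation.Binary.PropositionalEquality
  using (_≡_; _≢_; refl; sym; trans; cong; subst; subst₂; module ≡-Reasoning)

open ≡-Reasoning

[m%d+n]%d≡[m+n]%d : ∀ m n d .{{_ : NonZero d}} → (m % d + n) % d ≡ (m + n) % d
[m%d+n]%d≡[m+n]%d m n d = begin
  (m % d + n) % d          ≡⟨ %-distribˡ-+ (m % d) n d ⟩
  (m % d % d + n % d) % d  ≡⟨ cong (λ x → (x + n % d) % d) (m%n%n≡m%n m d) ⟩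
  (m % d + n % d) % d      ≡⟨ %-distribˡ-+ m n d ⟨
  (m + n) % d              ∎

[m+n]%d≢m : ∀ {m n d} .{{_ : NonZero d}} → m < d → 0 < n → n < d → (m + n) % d ≢ m
[m+n]%d≢m {m} {n} {d} m<d 0<n n<d with m + n <? d
... | yes noWrap = λ e → <-irrefl (sym (trans (sym (m<n⇒m%n≡m noWrap)) e)) (m<m+n m 0<n)
... | no wrap    = λ e → <-irrefl (trans (sym wrapped) e) below
  where
  below : m + n ∸ d < m
  below = subst (m + n ∸ d <_) (m+n∸n≡m m d) (∸-monoˡ-< (+-monoʳ-< m n<d) (≮⇒≥ wrap))
  wrapped : (m + n) % d ≡ m + n ∸ d
  wrapped = trans (sym (m≤n⇒[n∸m]%m≡n%m (≮⇒≥ wrap))) (m<n⇒m%n≡m (<-trans below m<d))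

iterate-invariant : ∀ {A B : Set} (f : A → B) (g : A → A) → (∀ x → f (g x) ≡ f x) →
                    ∀ x r → f (iterate g x r) ≡ f x
iterate-invariant f g inv x zero    = refl
iterate-invariant f g inv x (suc r) = trans (iterate-invariant f g inv (g x) r) (inv x)

module _ {k : ℕ} .{{_ : NonZero k}} where

  next : Fin k → Fin k
  next i = suc (toℕ i) mod k

  toℕ-next : ∀ i → toℕ (next i) ≡ suc (toℕ i) % k
  toℕ-next i = toℕ-fromℕ< _

  suc-toℕ⇒next : ∀ {i j} → suc (toℕ i) ≡ toℕ j → next i ≡ j
  suc-toℕ⇒next {i} {j} e = toℕ-injective (begin
    toℕ (next i)       ≡⟨ toℕ-next i ⟩
    suc (toℕ i) % k    ≡⟨ cong (_% k) e ⟩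
    toℕ j % k          ≡⟨ m<n⇒m%n≡m (toℕ<n j) ⟩
    toℕ j              ∎)

  toℕ-next-last : ∀ {i} → suc (toℕ i) ≡ k → toℕ (next i) ≡ 0
  toℕ-next-last {i} e = trans (toℕ-next i) (trans (cong (_% k) e) (n%n≡0 k))

  CycAdj-next : ∀ i → CycAdj k i (next i)
  CycAdj-next i with m≤n⇒m<n∨m≡n (toℕ<n i)
  ... | inj₁ notLast = inj₁ (sym (trans (toℕ-next i) (m<n⇒m%n≡m notLast)))
  ... | inj₂ last    = inj₂ (inj₂ (inj₂ (toℕ-next-last last , last)))

  CycAdj-sym : ∀ {i j} → CycAdj k i j → CycAdj k j i
  CycAdj-sym (inj₁ e)                = inj₂ (inj₁ e)
  CycAdj-sym (inj₂ (inj₁ e))         = inj₁ e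
  CycAdj-sym (inj₂ (inj₂ (inj₁ p)))  = inj₂ (inj₂ (inj₂ p))
  CycAdj-sym (inj₂ (inj₂ (inj₂ p)))  = inj₂ (inj₂ (inj₁ p))

  CycAdj⇔next : ∀ i j → CycAdj k i j ⇔ (j ≡ next i ⊎ i ≡ next j)
  CycAdj⇔next i j = mk⇔ to from
    where
    to : CycAdj k i j → j ≡ next i ⊎ i ≡ next j
    to (inj₁ e)                           = inj₁ (sym (suc-toℕ⇒next e))
    to (inj₂ (inj₁ e))                    = inj₂ (sym (suc-toℕ⇒next e))
    to (inj₂ (inj₂ (inj₁ (i≡0 , last))))  = inj₂ (toℕ-injective (trans i≡0 (sym (toℕ-next-last last))))
    to (inj₂ (inj₂ (inj₂ (j≡0 , last))))  = inj₁ (toℕ-injective (trans j≡0 (sym (toℕ-next-last last))))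

    from : j ≡ next i ⊎ i ≡ next j → CycAdj k i j
    from (inj₁ refl) = CycAdj-next i
    from (inj₂ refl) = CycAdj-sym (CycAdj-next j)

  toℕ-iterate-next : ∀ i r → toℕ (iterate next i r) ≡ (toℕ i + r) % k
  toℕ-iterate-next i zero = sym (trans (cong (_% k) (+-identityʳ (toℕ i))) (m<n⇒m%n≡m (toℕ<n i)))
  toℕ-iterate-next i (suc r) = begin
    toℕ (iterate next (next i) r)  ≡⟨ toℕ-iterate-next (next i) r ⟩
    (toℕ (next i) + r) % k         ≡⟨ cong (λ x → (x + r) % k) (toℕ-next i) ⟩
    (suc (toℕ i) % k + r) % k      ≡⟨ [m%d+n]%d≡[m+n]%d (suc (toℕ i)) r k ⟩
    (suc (toℕ i) + r) % k          ≡⟨ cong (_% k) (+-suc (toℕ i) r) ⟨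
    (toℕ i + suc r) % k            ∎

  iterate-next-≢ : ∀ i {r} → 0 < r → r < k → iterate next i r ≢ i
  iterate-next-≢ i {r} 0<r r<k loop =
    [m+n]%d≢m (toℕ<n i) 0<r r<k (trans (sym (toℕ-iterate-next i r)) (cong toℕ loop))

  inducedCycleR-intro : ∀ {n} {R : Fin n → Fin n → Set} → (∀ {u w} → R u w → R w u) →
                        (v : Fin k → Fin n) → Injective _≡_ _≡_ v →
                        (∀ i → R (v i) (v (next i))) →
                        (∀ {i j} → R (v i) (v j) → j ≡ next i ⊎ i ≡ next j) →
                        InducedCycleR R k
  inducedCycleR-intro {R = R} R-sym v v-injective adjacent-next adjacent⇒ =
    v , v-injective , λ i j → ⇔-trans (mk⇔ adjacent⇒ (from i j)) (⇔-sym (CycAdj⇔next i j))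
    where
    from : ∀ i j → j ≡ next i ⊎ i ≡ next j → R (v i) (v j)
    from i _ (inj₁ refl) = adjacent-next i
    from _ j (inj₂ refl) = R-sym (adjacent-next j)

module _ {k : ℕ} where

  iterate-next-zero : ∀ (i : Fin (suc k)) → iterate next zero (toℕ i) ≡ i
  iterate-next-zero i = toℕ-injective (trans (toℕ-iterate-next zero (toℕ i)) (m<n⇒m%n≡m (toℕ<n i)))

  next-invariant⇒constant : ∀ {A : Set} (f : Fin (suc k) → A) → (∀ i → f (next i) ≡ f i) →
                            ∀ i → f i ≡ f zero
  next-invariant⇒constant f inv i = begin
    f i                             ≡⟨ cong f (iterate-next-zero i) ⟨
    f (iterate next zero (toℕ i))   ≡⟨ iterate-invariant f next inv zero (toℕ i) ⟩
    f zero                          ∎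

module _ {k : ℕ} .{{_ : NonZero k}} where
  private instance
    nonZero-k*2 : NonZero (k * 2)
    nonZero-k*2 = m*n≢0 k 2

  next-combine-0 : ∀ (i : Fin k) → next (combine {n = 2} i 0F) ≡ combine i 1F
  next-combine-0 i = suc-toℕ⇒next (begin
    suc (toℕ (combine {n = 2} i 0F))  ≡⟨ cong suc (toℕ-combine i 0F) ⟩
    suc (2 * toℕ i + 0)               ≡⟨ cong suc (+-identityʳ (2 * toℕ i)) ⟩
    suc (2 * toℕ i)                   ≡⟨ +-comm (2 * toℕ i) 1 ⟨
    2 * toℕ i + 1                     ≡⟨ toℕ-combine i 1F ⟨
    toℕ (combine {n = 2} i 1F)        ∎)

  next-combine-1 : ∀ (i : Fin k) → next (combine {n = 2} i 1F) ≡ combine (next i) 0F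
  next-combine-1 i = toℕ-injective (begin
    toℕ (next (combine {n = 2} i 1F))           ≡⟨ toℕ-next (combine i 1F) ⟩
    suc (toℕ (combine {n = 2} i 1F)) % (k * 2)  ≡⟨ cong (λ x → suc x % (k * 2)) (toℕ-combine i 1F) ⟩
    suc (2 * toℕ i + 1) % (k * 2)               ≡⟨ cong (λ x → suc x % (k * 2)) (+-comm (2 * toℕ i) 1) ⟩
    (2 + 2 * toℕ i) % (k * 2)                   ≡⟨ cong (λ x → (2 + x) % (k * 2)) (*-comm 2 (toℕ i)) ⟩
    suc (toℕ i) * 2 % (k * 2)                   ≡⟨ m%n*o≡m*o%[n*o] (suc (toℕ i)) k 2 ⟨
    suc (toℕ i) % k * 2                         ≡⟨ cong (_* 2) (toℕ-next i) ⟨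
    toℕ (next i) * 2                            ≡⟨ *-comm (toℕ (next i)) 2 ⟩
    2 * toℕ (next i)                            ≡⟨ +-identityʳ _ ⟨
    2 * toℕ (next i) + 0                        ≡⟨ toℕ-combine (next i) 0F ⟨
    toℕ (combine {n = 2} (next i) 0F)           ∎)

  module Ladder {n} (G : Graph n) (a b : Fin k → Fin n)
    (a-injective : Injective _≡_ _≡_ a) (b-injective : Injective _≡_ _≡_ b)
    (a≢b : ∀ i j → a i ≢ b j)
    (a-independent : ∀ i j → ¬ Adj G (a i) (a j)) (b-independent : ∀ i j → ¬ Adj G (b i) (b j))
    (a-b-adjacent : ∀ i j → Adj G (a i) (b j) ⇔ (i ≡ j ⊎ i ≡ next j)) where

    vertex : Fin k × Fin 2 → Fin n
    vertex (i , 0F) = a i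
    vertex (i , 1F) = b i

    -- combine i 0F and combine i 1F are the positions 2i and 2i + 1 of the 2k-cycle.
    zigzag : Fin (k * 2) → Fin n
    zigzag = vertex ∘ remQuot {k} 2

    zigzag-combine : ∀ i x → zigzag (combine i x) ≡ vertex (i , x)
    zigzag-combine i x = cong vertex (remQuot-combine i x)

    vertex-injective : Injective _≡_ _≡_ vertex
    vertex-injective {i , 0F} {j , 0F} e with refl ← a-injective e = refl
    vertex-injective {i , 0F} {j , 1F} e = ⊥-elim (a≢b i j e)
    vertex-injective {i , 1F} {j , 0F} e = ⊥-elim (a≢b j i (sym e))
    vertex-injective {i , 1F} {j , 1F} e with refl ← b-injective e = refl

    zigzag-injective : Injective _≡_ _≡_ zigzag
    zigzag-injective {m} {m′} e = begin
      m                                   ≡⟨ combine-remQuot {k} 2 m ⟨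
      uncurry combine (remQuot {k} 2 m)   ≡⟨ cong (uncurry combine) (vertex-injective {x = remQuot 2 m} e) ⟩
      uncurry combine (remQuot {k} 2 m′)  ≡⟨ combine-remQuot {k} 2 m′ ⟩
      m′                                  ∎

    zigzag-adjacent-next : ∀ m → Adj G (zigzag m) (zigzag (next m))
    zigzag-adjacent-next m with combine-surjective {k} {2} m
    ... | i , 0F , refl
      rewrite next-combine-0 i | zigzag-combine i 0F | zigzag-combine i 1F
      = Equivalence.from (a-b-adjacent i i) (inj₁ refl)
    ... | i , 1F , refl
      rewrite next-combine-1 i | zigzag-combine i 1F | zigzag-combine (next i) 0F
      = adj-sym G (Equivalence.from (a-b-adjacent (next i) i) (inj₂ refl))

    vertex-adjacent⇒ : ∀ i x j y → Adj G (vertex (i , x)) (vertex (j , y)) →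
                       combine j y ≡ next (combine i x) ⊎ combine i x ≡ next (combine j y)
    vertex-adjacent⇒ i 0F j 0F e = ⊥-elim (a-independent i j e)
    vertex-adjacent⇒ i 1F j 1F e = ⊥-elim (b-independent i j e)
    vertex-adjacent⇒ i 0F j 1F e with Equivalence.to (a-b-adjacent i j) e
    ... | inj₁ refl = inj₁ (sym (next-combine-0 i))
    ... | inj₂ refl = inj₂ (sym (next-combine-1 j))
    vertex-adjacent⇒ i 1F j 0F e = swap (vertex-adjacent⇒ j 0F i 1F (adj-sym G e))

    zigzag-adjacent⇒ : ∀ {m m′} → Adj G (zigzag m) (zigzag m′) → m′ ≡ next m ⊎ m ≡ next m′
    zigzag-adjacent⇒ {m} {m′} e
      with combine-surjective {k} {2} m | combine-surjective {k} {2} m′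
    ... | i , x , refl | j , y , refl =
      vertex-adjacent⇒ i x j y (subst₂ (Adj G) (zigzag-combine i x) (zigzag-combine j y) e)

    inducedCycle : InducedCycle G (k * 2)
    inducedCycle =
      inducedCycleR-intro {R = Adj G} (adj-sym G) zigzag zigzag-injective
                          zigzag-adjacent-next zigzag-adjacent⇒

module _ {n} (G : Graph n) (colour : Fin n → Bool)
         (proper : ∀ u v → Adj G u v → colour u ≢ colour v) where

  Dist2⇒sameColour : ∀ {u v} → Dist2 G u v → colour u ≡ colour v
  Dist2⇒sameColour (_ , _ , _ , uw , wv) =
    trans (¬-not (proper _ _ uw)) (sym (¬-not (proper _ _ (adj-sym G wv))))

  module StarCycle {k} (4≤k : 4 ≤ suc k)
    (v : Fin (suc k) → Fin n) (v-injective : Injective _≡_ _≡_ v)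
    (v-cycle : ∀ i j → Dist2 G (v i) (v j) ⇔ CycAdj (suc k) i j) where

    v-cycle-next : ∀ i j → Dist2 G (v i) (v j) ⇔ (j ≡ next i ⊎ i ≡ next j)
    v-cycle-next i j = ⇔-trans (v-cycle i j) (CycAdj⇔next i j)

    consecutive : ∀ {i j} → Dist2 G (v i) (v j) → j ≡ next i ⊎ i ≡ next j
    consecutive {i} {j} = Equivalence.to (v-cycle-next i j)

    Dist2-next : ∀ i → Dist2 G (v i) (v (next i))
    Dist2-next i = Equivalence.from (v-cycle-next i (next i)) (inj₁ refl)

    colour-v : ∀ i → colour (v i) ≡ colour (v zero)
    colour-v = next-invariant⇒constant (colour ∘ v) (λ i → sym (Dist2⇒sameColour (Dist2-next i)))

    v-independent : ∀ i j → ¬ Adj G (v i) (v j)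
    v-independent i j e = proper _ _ e (trans (colour-v i) (sym (colour-v j)))

    b : Fin (suc k) → Fin n
    b i = proj₁ (proj₂ (proj₂ (Dist2-next i)))

    v-b-adjacent : ∀ i → Adj G (v i) (b i)
    v-b-adjacent i = proj₁ (proj₂ (proj₂ (proj₂ (Dist2-next i))))

    b-v-next-adjacent : ∀ i → Adj G (b i) (v (next i))
    b-v-next-adjacent i = proj₂ (proj₂ (proj₂ (proj₂ (Dist2-next i))))

    colour-b : ∀ i → colour (b i) ≢ colour (v zero)
    colour-b i e = proper _ _ (v-b-adjacent i) (trans (colour-v i) (sym e))

    b-independent : ∀ i j → ¬ Adj G (b i) (b j)
    b-independent i j e = proper _ _ e (trans (¬-not (colour-b i)) (sym (¬-not (colour-b j))))

    v≢b : ∀ i j → v i ≢ b j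
    v≢b i j e = colour-b j (trans (cong colour (sym e)) (colour-v i))

    common-neighbour⇒consecutive : ∀ {i j u} → i ≢ j → Adj G (v i) u → Adj G u (v j) →
                                   j ≡ next i ⊎ i ≡ next j
    common-neighbour⇒consecutive {i} {j} {u} i≢j vu uv =
      consecutive (i≢j ∘ v-injective , v-independent i j , u , vu , uv)

    v-b-adjacent⇒ : ∀ {i j} → Adj G (v i) (b j) → i ≡ j ⊎ i ≡ next j
    v-b-adjacent⇒ {i} {j} e with i ≟ j | i ≟ next j
    ... | yes i≡j | _        = inj₁ i≡j
    ... | no _    | yes i≡j⁺ = inj₂ i≡j⁺
    -- b j is a common neighbour of v i with v j and with v (next j): this forces j = next i,
    -- and then a closed walk of 1 or 3 steps around the cycle.
    ... | no i≢j  | no i≢j⁺ with common-neighbour⇒consecutive i≢j e (adj-sym G (v-b-adjacent j))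
    ...   | inj₂ i≡j⁺ = ⊥-elim (i≢j⁺ i≡j⁺)
    ...   | inj₁ refl with common-neighbour⇒consecutive i≢j⁺ e (b-v-next-adjacent (next i))
    ...     | inj₁ loop = ⊥-elim (iterate-next-≢ (next i) z<s 1<k loop)
      where
      1<k : 1 < suc k
      1<k = ≤-trans (s≤s (s≤s z≤n)) 4≤k
    ...     | inj₂ loop = ⊥-elim (iterate-next-≢ i z<s 4≤k (sym loop))

    b-injective : Injective _≡_ _≡_ b
    b-injective {i} {j} e
      with v-b-adjacent⇒ (subst (Adj G (v i)) e (v-b-adjacent i))
         | v-b-adjacent⇒ (subst (Adj G (v j)) (sym e) (v-b-adjacent j))
    ... | inj₁ i≡j  | _          = i≡j
    ... | _         | inj₁ j≡i   = sym j≡i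
    ... | inj₂ i≡j⁺ | inj₂ refl  = ⊥-elim (iterate-next-≢ i z<s 2<k (sym i≡j⁺))
      where
      2<k : 2 < suc k
      2<k = ≤-trans (s≤s (s≤s (s≤s z≤n))) 4≤k

    v-b-adjacent⇔ : ∀ i j → Adj G (v i) (b j) ⇔ (i ≡ j ⊎ i ≡ next j)
    v-b-adjacent⇔ i j = mk⇔ v-b-adjacent⇒ from
      where
      from : i ≡ j ⊎ i ≡ next j → Adj G (v i) (b j)
      from (inj₁ refl) = v-b-adjacent i
      from (inj₂ refl) = adj-sym G (b-v-next-adjacent j)

    inducedCycle : InducedCycle G (suc k * 2)
    inducedCycle =
      Ladder.inducedCycle G v b v-injective b-injective v≢b v-independent b-independent v-b-adjacent⇔

mainTheorem19 : ∀ {n : ℕ} (G : Graph n) → ChordalBipartite G → ChordalR (Star G)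
mainTheorem19 G ((colour , proper) , noLongCycle) zero () _
mainTheorem19 G ((colour , proper) , noLongCycle) (suc k) 4≤k (v , v-injective , v-cycle) =
  noLongCycle (suc k * 2) (*-monoˡ-≤ 2 (≤-trans (n≤1+n 3) 4≤k))
    (StarCycle.inducedCycle G colour proper 4≤k v v-injective v-cycle)
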